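{- Let $p$ be a prime and let $\mathbf a,\mathbf k,\mathbf L,\mathbf N\in\mathbb{Z}^d$ satisfy $\mathbf k\ge\mathbf 0$, $\mathbf 0\le\mathbf L\le\mathbf N$, and $0\le a_i<p$ for $i=1,\dots,d$. Then $$B(\mathbf N,\mathbf a+p\mathbf k)\Big(H_{\lfloor \frac{1}{p}\mathbf L\cdot\mathbf a\rfloor+\mathbf L\cdot\mathbf k}-H_{\mathbf L\cdot\mathbf k}\Big)\in p\mathbb{Z}_p.$$
   Context: For $\mathbf P,\mathbf m\in\mathbb{Z}^d$ with $\mathbf P\ge\mathbf 0$, $\mathbf m\ge\mathbf 0$, $B(\mathbf P,\mathbf m)=\big(\sum_{i=1}^dP_im_i\big)!\big/\prod_{i=1}^dm_i!^{P_i}$. $\mathbf L\cdot\mathbf k=\sum_i L_ik_i$ is the scalar product. $H_m=\sum_{j=1}^m1/j$ with $H_0=0$. Vector inequalities are componentwise. $\mathbb{Z}_p$ denotes the $p$-adic integers. -}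

module Defs where

open import Data.Nat using (ℕ; zero; suc; _+_; _*_; _^_; NonZero)
open import Data.Nat.DivMod using (_/_)
open import Data.Nat.Properties using (m*n≢0; m^n≢0; _!≢0)
open import Data.Nat.Combinatorics using ()
open import Data.Nat using (_!)
open import Data.Fin using (Fin)
import Data.Fin as F
open import Data.Integer using (ℤ; +_; ∣_∣)
open import Data.Integer.Divisibility using () renaming (_∣_ to _∣ℤ_)
open import Data.Nat.Divisibility using (_∣_)
open import Data.Rational using (ℚ; 0ℚ) renaming (_/_ to _÷ℕ_; _+_ to _+ℚ_)
open import Data.Product using (∃; _×_)
open import Relation.Nullary using (¬_)
open import Relation.Binary.PropositionalEquality using (_≡_)

dot : ∀ {d} → (Fin d → ℕ) → (Fin d → ℕ) → ℕ
dot {zero}  u v = 0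
dot {suc d} u v = u F.zero * v F.zero + dot (λ i → u (F.suc i)) (λ i → v (F.suc i))

prodFactPow : ∀ {d} → (Fin d → ℕ) → (Fin d → ℕ) → ℕ
prodFactPow {zero}  P m = 1
prodFactPow {suc d} P m =
  ((m F.zero !) ^ P F.zero) * prodFactPow (λ i → P (F.suc i)) (λ i → m (F.suc i))

prodFactPow-nz : ∀ {d} (P m : Fin d → ℕ) → NonZero (prodFactPow P m)
prodFactPow-nz {zero}  P m = _
prodFactPow-nz {suc d} P m =
  let instance
        _ = m F.zero !≢0
        _ = m^n≢0 (m F.zero !) (P F.zero)
        _ = prodFactPow-nz (λ i → P (F.suc i)) (λ i → m (F.suc i))
  in m*n≢0 ((m F.zero !) ^ P F.zero) (prodFactPow (λ i → P (F.suc i)) (λ i → m (F.suc i)))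

B : ∀ {d} → (Fin d → ℕ) → (Fin d → ℕ) → ℚ
B P m = ((+ (dot P m !)) ÷ℕ prodFactPow P m) {{prodFactPow-nz P m}}

H : ℕ → ℚ
H zero    = 0ℚ
H (suc m) = H m +ℚ (+ 1 ÷ℕ suc m)

-- ⌊ n / p ⌋ for natural n (only used with p prime, so p ≠ 0)
floorDiv : ℕ → ℕ → ℕ
floorDiv n zero    = 0
floorDiv n (suc q) = n / suc q

InPZp : ℕ → ℚ → Set
InPZp p q = ∃ λ (n : ℤ) → ∃ λ (e : ℕ) →
  (¬ (p ∣ suc e)) × ((+ p) ∣ℤ n) × (q ≡ (n ÷ℕ suc e))

-- Write ν! n for νₚ(n!). Each summand B · 1/(j+1) of B (H_{s+t} − H_t), t ≤ j < s + t, where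
-- t = L·k and s = ⌊L·a/p⌋, has p-adic valuation ν!(M) − Σᵢ Nᵢ ν!(aᵢ + p kᵢ) − νₚ(j+1) with
-- M = N·(a + p k). Legendre's formula ν!(p q + r) = q + ν! q (r < p) turns this into
--   (⌊N·a/p⌋ + N·k) + ν!(⌊N·a/p⌋ + N·k) − N·k − Σᵢ Nᵢ ν!(kᵢ) − νₚ(j+1),
-- which is positive because ν! is superadditive: Σᵢ Nᵢ ν!(kᵢ) ≤ ν!(L·k) + ν!((N−L)·k),
-- ν!(L·k) + νₚ(j+1) ≤ ν!(j+1) ≤ ν!(s + t), and ⌊N·a/p⌋ ≥ s ≥ 1 once some such j exists.
module Submission where

open import Defs
open import Data.Nat using (ℕ; _+_; _*_; _≤_; _<_)
open import Data.Nat.Primality using (Prime)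
open import Data.Fin using (Fin)
open import Data.Rational using (ℚ) renaming (_*_ to _*ℚ_; _-_ to _-ℚ_)

open import Data.Nat using (zero; suc; _∸_; _^_; _!; pred; NonZero; ≢-nonZero; ≢-nonZero⁻¹; nonTrivial⇒n>1; z≤n)
open import Data.Nat.Properties
open import Data.Nat.DivMod using (_/_; _%_; m≡m%n+[m/n]*n; m%n<n; /-monoˡ-≤)
open import Data.Nat.Divisibility using (_∣_; divides; _∣?_; _∣0; ∣1⇒≡1; ∣m∣n⇒∣m+n; ∣m⇒∣m*n; m∣m*n; ∣m+n∣m⇒∣n; >⇒∤)
open import Data.Nat.Primality using (euclidsLemma; prime⇒nonZero; prime⇒nonTrivial)
open import Data.Nat.Combinatorics using (k![n∸k]!∣n!)
open import Data.Nat.Induction using (<-rec)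
open import Data.Nat.Solver using (module +-*-Solver)
open import Data.Integer using (+_)
import Data.Integer as ℤ
import Data.Integer.Properties as ℤₚ
open import Data.Rational using (0ℚ; toℚᵘ; -_) renaming (_/_ to _÷_; _+_ to _+ℚ_)
import Data.Rational.Properties as ℚₚ
open import Data.Rational.Unnormalised as ℚᵘ using (mkℚᵘ; _≃_)
import Data.Rational.Unnormalised.Properties as ℚᵘₚ
import Data.Fin as Fin
open import Data.Vec.Functional using (head; tail)
open import Data.Product using (∃; ∃₂; _×_; _,_; proj₁; proj₂; map)
open import Data.Sum using (inj₁; inj₂)
open import Relation.Nullary using (¬_; yes; no; contradiction)
open import Relation.Binary.PropositionalEquality
open import Function using (_∘_)

open +-*-Solver

toℚᵘ-/ : ∀ i n → toℚᵘ (i ÷ suc n) ≃ mkℚᵘ i n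
toℚᵘ-/ i n = ℚₚ.toℚᵘ-fromℚᵘ (mkℚᵘ i n)

+-/ : ∀ a b c d → (+ a ÷ suc b) +ℚ (+ c ÷ suc d) ≡ + (a * suc d + c * suc b) ÷ (suc b * suc d)
+-/ a b c d = ℚₚ.toℚᵘ-injective (begin
    toℚᵘ (+ a ÷ suc b +ℚ + c ÷ suc d)      ≈⟨ ℚₚ.toℚᵘ-homo-+ (+ a ÷ suc b) (+ c ÷ suc d) ⟩
    toℚᵘ (+ a ÷ suc b) ℚᵘ.+ toℚᵘ (+ c ÷ suc d) ≈⟨ ℚᵘₚ.+-cong (toℚᵘ-/ (+ a) b) (toℚᵘ-/ (+ c) d) ⟩
    mkℚᵘ (+ a) b ℚᵘ.+ mkℚᵘ (+ c) d          ≡⟨ cong (λ z → mkℚᵘ z _) numerator ⟩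
    mkℚᵘ (+ (a * suc d + c * suc b)) _      ≈⟨ ℚᵘₚ.≃-sym (toℚᵘ-/ _ _) ⟩
    toℚᵘ (+ (a * suc d + c * suc b) ÷ (suc b * suc d)) ∎)
  where
  open ℚᵘₚ.≃-Reasoning
  numerator : + a ℤ.* + suc d ℤ.+ + c ℤ.* + suc b ≡ + (a * suc d + c * suc b)
  numerator = trans (cong₂ ℤ._+_ (sym (ℤₚ.pos-* a (suc d))) (sym (ℤₚ.pos-* c (suc b))))
                    (sym (ℤₚ.pos-+ (a * suc d) (c * suc b)))

*-/ : ∀ a b c d .{{_ : NonZero b}} .{{_ : NonZero d}} →
      (+ a ÷ b) *ℚ (+ c ÷ d) ≡ (+ (a * c) ÷ (b * d)) {{m*n≢0 b d}}
*-/ a (suc b) c (suc d) = ℚₚ.toℚᵘ-injective (begin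
    toℚᵘ ((+ a ÷ suc b) *ℚ (+ c ÷ suc d))        ≈⟨ ℚₚ.toℚᵘ-homo-* (+ a ÷ suc b) (+ c ÷ suc d) ⟩
    toℚᵘ (+ a ÷ suc b) ℚᵘ.* toℚᵘ (+ c ÷ suc d) ≈⟨ ℚᵘₚ.*-cong (toℚᵘ-/ (+ a) b) (toℚᵘ-/ (+ c) d) ⟩
    mkℚᵘ (+ a) b ℚᵘ.* mkℚᵘ (+ c) d             ≡⟨ cong (λ z → mkℚᵘ z _) (sym (ℤₚ.pos-* a c)) ⟩
    mkℚᵘ (+ (a * c)) _                         ≈⟨ ℚᵘₚ.≃-sym (toℚᵘ-/ _ _) ⟩
    toℚᵘ (+ (a * c) ÷ (suc b * suc d))         ∎)
  where open ℚᵘₚ.≃-Reasoning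

*≡*⇒/≡/ : ∀ a b c d → a * suc d ≡ c * suc b → + a ÷ suc b ≡ + c ÷ suc d
*≡*⇒/≡/ a b c d eq = ℚₚ.fromℚᵘ-cong {mkℚᵘ (+ a) b} {mkℚᵘ (+ c) d} (ℚᵘ.*≡* (begin
    + a ℤ.* + suc d  ≡⟨ ℤₚ.pos-* a (suc d) ⟨
    + (a * suc d)    ≡⟨ cong +_ eq ⟩
    + (c * suc b)    ≡⟨ ℤₚ.pos-* c (suc b) ⟩
    + c ℤ.* + suc b  ∎))
  where open ≡-Reasoning

*-[x+y-z] : ∀ c x y z → c *ℚ ((x +ℚ y) -ℚ z) ≡ c *ℚ (x -ℚ z) +ℚ c *ℚ y
*-[x+y-z] c x y z = begin
    c *ℚ ((x +ℚ y) -ℚ z)       ≡⟨ cong (c *ℚ_) (ℚₚ.+-assoc x y (- z)) ⟩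
    c *ℚ (x +ℚ (y -ℚ z))       ≡⟨ cong (λ w → c *ℚ (x +ℚ w)) (ℚₚ.+-comm y (- z)) ⟩
    c *ℚ (x +ℚ (- z +ℚ y))     ≡⟨ cong (c *ℚ_) (ℚₚ.+-assoc x (- z) y) ⟨
    c *ℚ ((x -ℚ z) +ℚ y)       ≡⟨ ℚₚ.*-distribˡ-+ c (x -ℚ z) y ⟩
    c *ℚ (x -ℚ z) +ℚ c *ℚ y    ∎
  where open ≡-Reasoning

*-[x-x] : ∀ c x → c *ℚ (x -ℚ x) ≡ 0ℚ
*-[x-x] c x = trans (cong (c *ℚ_) (ℚₚ.+-inverseʳ x)) (ℚₚ.*-zeroʳ c)

dot-cong : ∀ {d} {P Q f g : Fin d → ℕ} → (∀ i → P i ≡ Q i) → (∀ i → f i ≡ g i) → dot P f ≡ dot Q g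
dot-cong {zero}  _   _   = refl
dot-cong {suc d} P≡Q f≡g =
  cong₂ _+_ (cong₂ _*_ (P≡Q Fin.zero) (f≡g Fin.zero)) (dot-cong (P≡Q ∘ Fin.suc) (f≡g ∘ Fin.suc))

dot-distribʳ-+ : ∀ {d} (P f g : Fin d → ℕ) → dot P (λ i → f i + g i) ≡ dot P f + dot P g
dot-distribʳ-+ {zero}  P f g = refl
dot-distribʳ-+ {suc d} P f g = begin
    head P * (head f + head g) + dot (tail P) (λ i → tail f i + tail g i)
      ≡⟨ cong (_+_ (head P * (head f + head g))) (dot-distribʳ-+ (tail P) (tail f) (tail g)) ⟩
    head P * (head f + head g) + (dot (tail P) (tail f) + dot (tail P) (tail g))
      ≡⟨ solve 5 (λ n x y A B → n :* (x :+ y) :+ (A :+ B) := (n :* x :+ A) :+ (n :* y :+ B)) refl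
               (head P) (head f) (head g) (dot (tail P) (tail f)) (dot (tail P) (tail g)) ⟩
    (head P * head f + dot (tail P) (tail f)) + (head P * head g + dot (tail P) (tail g)) ∎
  where open ≡-Reasoning

dot-distribˡ-+ : ∀ {d} (P Q f : Fin d → ℕ) → dot (λ i → P i + Q i) f ≡ dot P f + dot Q f
dot-distribˡ-+ {zero}  P Q f = refl
dot-distribˡ-+ {suc d} P Q f = begin
    (head P + head Q) * head f + dot (λ i → tail P i + tail Q i) (tail f)
      ≡⟨ cong (_+_ ((head P + head Q) * head f)) (dot-distribˡ-+ (tail P) (tail Q) (tail f)) ⟩
    (head P + head Q) * head f + (dot (tail P) (tail f) + dot (tail Q) (tail f))
      ≡⟨ solve 5 (λ x y n A B → (x :+ y) :* n :+ (A :+ B) := (x :* n :+ A) :+ (y :* n :+ B)) refl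
               (head P) (head Q) (head f) (dot (tail P) (tail f)) (dot (tail Q) (tail f)) ⟩
    (head P * head f + dot (tail P) (tail f)) + (head Q * head f + dot (tail Q) (tail f)) ∎
  where open ≡-Reasoning

dot-*ʳ : ∀ {d} (P f : Fin d → ℕ) c → dot P (λ i → c * f i) ≡ c * dot P f
dot-*ʳ {zero}  P f c = sym (*-zeroʳ c)
dot-*ʳ {suc d} P f c = begin
    head P * (c * head f) + dot (tail P) (λ i → c * tail f i)
      ≡⟨ cong (_+_ (head P * (c * head f))) (dot-*ʳ (tail P) (tail f) c) ⟩
    head P * (c * head f) + c * dot (tail P) (tail f)
      ≡⟨ solve 4 (λ n c x A → n :* (c :* x) :+ c :* A := c :* (n :* x :+ A)) refl
               (head P) c (head f) (dot (tail P) (tail f)) ⟩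
    c * (head P * head f + dot (tail P) (tail f)) ∎
  where open ≡-Reasoning

dot-∸-split : ∀ {d} (L N f : Fin d → ℕ) → (∀ i → L i ≤ N i) →
              dot N f ≡ dot L f + dot (λ i → N i ∸ L i) f
dot-∸-split L N f L≤N =
  trans (dot-cong (λ i → sym (m+[n∸m]≡n (L≤N i))) (λ _ → refl)) (dot-distribˡ-+ L (λ i → N i ∸ L i) f)

Superadditive : (ℕ → ℕ) → Set
Superadditive F = ∀ m n → F m + F n ≤ F (m + n)

module _ {F : ℕ → ℕ} (F-super : Superadditive F) where

  superadditive⇒mono : ∀ {m n} → m ≤ n → F m ≤ F n
  superadditive⇒mono {m} {n} m≤n = begin
    F m               ≤⟨ m≤m+n (F m) (F (n ∸ m)) ⟩
    F m + F (n ∸ m)   ≤⟨ F-super m (n ∸ m) ⟩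
    F (m + (n ∸ m))   ≡⟨ cong F (m+[n∸m]≡n m≤n) ⟩
    F n               ∎
    where open ≤-Reasoning

  superadditive-* : ∀ n m → n * F m ≤ F (n * m)
  superadditive-* zero    m = z≤n
  superadditive-* (suc n) m = ≤-trans (+-monoʳ-≤ (F m) (superadditive-* n m)) (F-super m (n * m))

  superadditive-dot : ∀ {d} (P k : Fin d → ℕ) → dot P (λ i → F (k i)) ≤ F (dot P k)
  superadditive-dot {zero}  P k = z≤n
  superadditive-dot {suc d} P k =
    ≤-trans (+-mono-≤ (superadditive-* (head P) (head k)) (superadditive-dot (tail P) (tail k)))
            (F-super (head P * head k) (dot (tail P) (tail k)))

module PAdic {p : ℕ} (p-prime : Prime p) where

  instance
    p≢0 : NonZero p
    p≢0 = prime⇒nonZero p-prime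

  p>1 : 1 < p
  p>1 = nonTrivial⇒n>1 p {{prime⇒nonTrivial p-prime}}

  p∤1 : ¬ p ∣ 1
  p∤1 p∣1 = <⇒≢ p>1 (sym (∣1⇒≡1 p∣1))

  p∤* : ∀ {m n} → ¬ p ∣ m → ¬ p ∣ n → ¬ p ∣ m * n
  p∤* {m} {n} p∤m p∤n p∣mn with euclidsLemma m n p-prime p∣mn
  ... | inj₁ p∣m = p∤m p∣m
  ... | inj₂ p∣n = p∤n p∣n

  infix 4 ν[_]≡_
  record ν[_]≡_ (n v : ℕ) : Set where
    constructor mkν
    field
      unit   : ℕ
      p∤unit : ¬ p ∣ unit
      n≡p^v* : n ≡ p ^ v * unit

  ν-unit : ∀ {n} → ¬ p ∣ n → ν[ n ]≡ 0
  ν-unit {n} p∤n = mkν n p∤n (sym (+-identityʳ n))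

  ν-p : ν[ p ]≡ 1
  ν-p = mkν 1 p∤1 (sym (trans (*-identityʳ (p * 1)) (*-identityʳ p)))

  ν-* : ∀ {m n u v} → ν[ m ]≡ u → ν[ n ]≡ v → ν[ m * n ]≡ u + v
  ν-* {m} {n} {u} {v} (mkν w p∤w m≡) (mkν w′ p∤w′ n≡) = mkν (w * w′) (p∤* p∤w p∤w′) (begin
    m * n                       ≡⟨ cong₂ _*_ m≡ n≡ ⟩
    (p ^ u * w) * (p ^ v * w′)  ≡⟨ solve 4 (λ x y z t → (x :* y) :* (z :* t) := (x :* z) :* (y :* t)) refl (p ^ u) w (p ^ v) w′ ⟩
    (p ^ u * p ^ v) * (w * w′)  ≡⟨ cong (_* (w * w′)) (^-distribˡ-+-* p u v) ⟨
    p ^ (u + v) * (w * w′)      ∎)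
    where open ≡-Reasoning

  ν-^ : ∀ {n v} → ν[ n ]≡ v → ∀ k → ν[ n ^ k ]≡ k * v
  ν-^ νn zero    = ν-unit p∤1
  ν-^ νn (suc k) = ν-* νn (ν-^ νn k)

  ν-unique : ∀ {n u v} → ν[ n ]≡ u → ν[ n ]≡ v → u ≡ v
  ν-unique (mkν w p∤w n≡) (mkν w′ p∤w′ n≡′) = go _ _ (trans (sym n≡) n≡′)
    where
    p∣p^suc : ∀ u x → p ∣ p ^ suc u * x
    p∣p^suc u x = divides (p ^ u * x) (solve 3 (λ p q x → (p :* q) :* x := (q :* x) :* p) refl p (p ^ u) x)
    go : ∀ u v → p ^ u * w ≡ p ^ v * w′ → u ≡ v
    go zero    zero    _  = refl
    go zero    (suc v) eq = contradiction (subst (p ∣_) (trans (sym eq) (+-identityʳ w)) (p∣p^suc v w′)) p∤w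
    go (suc u) zero    eq = contradiction (subst (p ∣_) (trans eq (+-identityʳ w′)) (p∣p^suc u w)) p∤w′
    go (suc u) (suc v) eq = cong suc (go u v (*-cancelˡ-≡ _ _ p
      (trans (sym (*-assoc p (p ^ u) w)) (trans eq (*-assoc p (p ^ v) w′)))))

  ν-exists : ∀ n → n ≢ 0 → ∃ (ν[ n ]≡_)
  ν-exists = <-rec _ step
    where
    step : ∀ n → (∀ {m} → m < n → m ≢ 0 → ∃ (ν[ m ]≡_)) → n ≢ 0 → ∃ (ν[ n ]≡_)
    step n rec n≢0 with p ∣? n
    ... | no p∤n = 0 , ν-unit p∤n
    ... | yes (divides c refl) =
      map suc (λ {v} νc → subst (ν[_]≡ suc v) (*-comm p c) (ν-* ν-p νc)) (rec (m<m*n c p p>1) c≢0)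
      where
      c≢0 : c ≢ 0
      c≢0 refl = n≢0 refl
      instance _ = ≢-nonZero c≢0

  ν-mono-∣ : ∀ {m n u v} → m ∣ n → n ≢ 0 → ν[ m ]≡ u → ν[ n ]≡ v → u ≤ v
  ν-mono-∣ {u = u} (divides c refl) n≢0 νm νn
    with w , νc ← ν-exists c (λ { refl → n≢0 refl })
    = subst (u ≤_) (ν-unique (ν-* νc νm) νn) (m≤n+m u w)

  opaque
    ν : ∀ n .{{_ : NonZero n}} → ℕ
    ν n = proj₁ (ν-exists n (≢-nonZero⁻¹ n))

    ν-spec : ∀ n .{{_ : NonZero n}} → ν[ n ]≡ ν n
    ν-spec n = proj₂ (ν-exists n (≢-nonZero⁻¹ n))

  ν-≡ : ∀ {n v} .{{_ : NonZero n}} → ν[ n ]≡ v → ν n ≡ v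
  ν-≡ {n} = ν-unique (ν-spec n)

  ν! : ℕ → ℕ
  ν! n = ν (n !) {{n !≢0}}

  ν!-spec : ∀ n → ν[ n ! ]≡ ν! n
  ν!-spec n = ν-spec (n !) {{n !≢0}}

  ν!-suc : ∀ n → ν! (suc n) ≡ ν (suc n) + ν! n
  ν!-suc n = ν-≡ {{suc n !≢0}} (ν-* (ν-spec (suc n)) (ν!-spec n))

  ν!-superadditive : Superadditive ν!
  ν!-superadditive m n =
    ν-mono-∣ m!*n!∣[m+n]! (≢-nonZero⁻¹ _ {{m + n !≢0}}) (ν-* (ν!-spec m) (ν!-spec n)) (ν!-spec (m + n))
    where
    m!*n!∣[m+n]! : m ! * n ! ∣ (m + n) !
    m!*n!∣[m+n]! = subst (λ z → m ! * z ! ∣ (m + n) !) (m+n∸m≡n m n) (k![n∸k]!∣n! (m≤m+n m n))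

  ν!-mono : ∀ {m n} → m ≤ n → ν! m ≤ ν! n
  ν!-mono = superadditive⇒mono {F = ν!} ν!-superadditive

  ν!+ν≤ν!-suc : ∀ {t j} → t ≤ j → ν! t + ν (suc j) ≤ ν! (suc j)
  ν!+ν≤ν!-suc {t} {j} t≤j = begin
    ν! t + ν (suc j)  ≤⟨ +-monoˡ-≤ (ν (suc j)) (ν!-mono t≤j) ⟩
    ν! j + ν (suc j)  ≡⟨ +-comm (ν! j) (ν (suc j)) ⟩
    ν (suc j) + ν! j  ≡⟨ ν!-suc j ⟨
    ν! (suc j)        ∎
    where open ≤-Reasoning

  ν!-p*q+r≡ν!-p*q : ∀ q {r} → r < p → ν! (p * q + r) ≡ ν! (p * q)
  ν!-p*q+r≡ν!-p*q q {zero}  _   = cong ν! (+-identityʳ (p * q))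
  ν!-p*q+r≡ν!-p*q q {suc r} r<p = begin
    ν! (p * q + suc r)                  ≡⟨ cong ν! (+-suc (p * q) r) ⟩
    ν! (suc (p * q + r))                ≡⟨ ν!-suc (p * q + r) ⟩
    ν (suc (p * q + r)) + ν! (p * q + r) ≡⟨ cong₂ _+_ (ν-≡ (ν-unit p∤)) (ν!-p*q+r≡ν!-p*q q (<-trans (n<1+n r) r<p)) ⟩
    ν! (p * q)                          ∎
    where
    open ≡-Reasoning
    p∤ : ¬ p ∣ suc (p * q + r)
    p∤ p∣ = >⇒∤ r<p (∣m+n∣m⇒∣n (subst (p ∣_) (sym (+-suc (p * q) r)) p∣) (m∣m*n q))

  ν!-p*q : ∀ q → ν! (p * q) ≡ q + ν! q
  ν!-p*q zero    = cong ν! (*-zeroʳ p)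
  ν!-p*q (suc q) = begin
    ν! (p * suc q)                                  ≡⟨ cong ν! p*suc-q≡suc ⟩
    ν! (suc (p * q + pred p))                       ≡⟨ ν!-suc (p * q + pred p) ⟩
    ν (suc (p * q + pred p)) + ν! (p * q + pred p)  ≡⟨ cong₂ _+_ ν-top ν!-rest ⟩
    suc (ν (suc q)) + (q + ν! q)                    ≡⟨ cong suc (solve 3 (λ a b c → a :+ (b :+ c) := b :+ (a :+ c)) refl (ν (suc q)) q (ν! q)) ⟩
    suc q + (ν (suc q) + ν! q)                      ≡⟨ cong (_+_ (suc q)) (ν!-suc q) ⟨
    suc q + ν! (suc q)                              ∎
    where
    open ≡-Reasoning
    p*suc-q≡suc : p * suc q ≡ suc (p * q + pred p)
    p*suc-q≡suc = trans (*-suc p q) (trans (cong (_+ p * q) (sym (suc-pred p))) (cong suc (+-comm (pred p) (p * q))))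
    ν-top : ν (suc (p * q + pred p)) ≡ suc (ν (suc q))
    ν-top = ν-≡ (subst (ν[_]≡ suc (ν (suc q))) p*suc-q≡suc (ν-* ν-p (ν-spec (suc q))))
    ν!-rest : ν! (p * q + pred p) ≡ q + ν! q
    ν!-rest = trans (ν!-p*q+r≡ν!-p*q q (≤-reflexive (suc-pred p))) (ν!-p*q q)

  ν!-legendre : ∀ q {r} → r < p → ν! (p * q + r) ≡ q + ν! q
  ν!-legendre q r<p = trans (ν!-p*q+r≡ν!-p*q q r<p) (ν!-p*q q)

  ν-prodFactPow : ∀ {d} (P m : Fin d → ℕ) → ν[ prodFactPow P m ]≡ dot P (λ i → ν! (m i))
  ν-prodFactPow {zero}  P m = ν-unit p∤1
  ν-prodFactPow {suc d} P m = ν-* (ν-^ (ν!-spec (head m)) (head P)) (ν-prodFactPow (tail P) (tail m))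

  ν!-+-p* : ∀ x y → ν! (x + p * y) ≡ (x / p + y) + ν! (x / p + y)
  ν!-+-p* x y = trans (cong ν! x+p*y≡) (ν!-legendre (x / p + y) (m%n<n x p))
    where
    x+p*y≡ : x + p * y ≡ p * (x / p + y) + x % p
    x+p*y≡ = trans (cong (_+ p * y) (m≡m%n+[m/n]*n x p))
      (solve 4 (λ r q p y → (r :+ q :* p) :+ p :* y := p :* (q :+ y) :+ r) refl (x % p) (x / p) p y)

  ν!-dot-p*+small : ∀ {d} (a k N : Fin d → ℕ) → (∀ i → a i < p) →
    dot N (λ i → ν! (a i + p * k i)) ≡ dot N k + dot N (λ i → ν! (k i))
  ν!-dot-p*+small a k N a<p = trans
    (dot-cong (λ _ → refl) (λ i → trans (cong ν! (+-comm (a i) (p * k i))) (ν!-legendre (k i) (a<p i))))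
    (dot-distribʳ-+ N k (λ i → ν! (k i)))

  ν!-dot+ν≤ν! : ∀ {d} (k L N : Fin d → ℕ) → (∀ i → L i ≤ N i) → ∀ s j →
    dot L k ≤ j → j < s + dot L k → dot N (λ i → ν! (k i)) + ν (suc j) ≤ ν! (s + dot N k)
  ν!-dot+ν≤ν! k L N L≤N s j t≤j j<s+t = begin
    dot N (ν! ∘ k) + ν (suc j)                     ≡⟨ cong (_+ ν (suc j)) (dot-∸-split L N (ν! ∘ k) L≤N) ⟩
    (dot L (ν! ∘ k) + dot D (ν! ∘ k)) + ν (suc j)  ≤⟨ +-monoˡ-≤ (ν (suc j)) (+-mono-≤ (ν!-dot L) (ν!-dot D)) ⟩
    (ν! t + ν! t′) + ν (suc j)                     ≡⟨ +-assoc (ν! t) (ν! t′) (ν (suc j)) ⟩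
    ν! t + (ν! t′ + ν (suc j))                     ≡⟨ cong (_+_ (ν! t)) (+-comm (ν! t′) (ν (suc j))) ⟩
    ν! t + (ν (suc j) + ν! t′)                     ≡⟨ +-assoc (ν! t) (ν (suc j)) (ν! t′) ⟨
    (ν! t + ν (suc j)) + ν! t′                     ≤⟨ +-monoˡ-≤ (ν! t′) (ν!+ν≤ν!-suc t≤j) ⟩
    ν! (suc j) + ν! t′                             ≤⟨ +-monoˡ-≤ (ν! t′) (ν!-mono j<s+t) ⟩
    ν! (s + t) + ν! t′                             ≤⟨ ν!-superadditive (s + t) t′ ⟩
    ν! (s + t + t′)                                ≡⟨ cong ν! (trans (+-assoc s t t′) (cong (_+_ s) (sym (dot-∸-split L N k L≤N)))) ⟩
    ν! (s + dot N k)                               ∎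
    where
    open ≤-Reasoning
    D = λ i → N i ∸ L i
    t = dot L k
    t′ = dot D k
    ν!-dot : ∀ P → dot P (ν! ∘ k) ≤ ν! (dot P k)
    ν!-dot P = superadditive-dot {F = ν!} ν!-superadditive P k

  ν-B-summand< : ∀ {d} (a k L N : Fin d → ℕ) → (∀ i → L i ≤ N i) → (∀ i → a i < p) → ∀ j →
    dot L k ≤ j → j < dot L a / p + dot L k →
    dot N (λ i → ν! (a i + p * k i)) + ν (suc j) < ν! (dot N (λ i → a i + p * k i))
  ν-B-summand< a k L N L≤N a<p j t≤j j<s+t = begin-strict
    dot N (λ i → ν! (a i + p * k i)) + ν (suc j) ≡⟨ cong (_+ ν (suc j)) (ν!-dot-p*+small a k N a<p) ⟩
    (Nk + dot N (ν! ∘ k)) + ν (suc j)             ≡⟨ +-assoc Nk (dot N (ν! ∘ k)) (ν (suc j)) ⟩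
    Nk + (dot N (ν! ∘ k) + ν (suc j))             ≤⟨ +-monoʳ-≤ Nk (ν!-dot+ν≤ν! k L N L≤N s j t≤j j<s+t) ⟩
    Nk + ν! (s + Nk)                              ≤⟨ +-monoʳ-≤ Nk (ν!-mono (+-monoˡ-≤ Nk s≤sN)) ⟩
    Nk + ν! (sN + Nk)                             <⟨ +-monoˡ-< (ν! (sN + Nk)) (m<n+m Nk (≤-trans 0<s s≤sN)) ⟩
    (sN + Nk) + ν! (sN + Nk)                      ≡⟨ ν!-+-p* (dot N a) Nk ⟨
    ν! (dot N a + p * Nk)                         ≡⟨ cong ν! (trans (dot-distribʳ-+ N a _) (cong (_+_ (dot N a)) (dot-*ʳ N k p))) ⟨
    ν! (dot N (λ i → a i + p * k i))              ∎
    where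
    open ≤-Reasoning
    s = dot L a / p
    sN = dot N a / p
    Nk = dot N k
    0<s : 0 < s
    0<s = +-cancelʳ-< (dot L k) 0 s (≤-<-trans t≤j j<s+t)
    s≤sN : s ≤ sN
    s≤sN = /-monoˡ-≤ p (subst (dot L a ≤_) (sym (dot-∸-split L N a L≤N)) (m≤m+n (dot L a) _))

  InPZp⁺ : ℚ → Set
  InPZp⁺ x = ∃₂ λ m e → p ∣ m × ¬ p ∣ suc e × x ≡ + m ÷ suc e

  InPZp⁺⇒InPZp : ∀ {x} → InPZp⁺ x → InPZp p x
  InPZp⁺⇒InPZp (m , e , p∣m , p∤e , x≡) = + m , e , p∤e , p∣m , x≡

  InPZp⁺-0 : InPZp⁺ 0ℚ
  InPZp⁺-0 = 0 , 0 , p ∣0 , p∤1 , refl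

  InPZp⁺-+ : ∀ {x y} → InPZp⁺ x → InPZp⁺ y → InPZp⁺ (x +ℚ y)
  InPZp⁺-+ (m , e , p∣m , p∤e , refl) (m′ , e′ , p∣m′ , p∤e′ , refl) =
    m * suc e′ + m′ * suc e , e′ + e * suc e′ ,
    ∣m∣n⇒∣m+n (∣m⇒∣m*n (suc e′) p∣m) (∣m⇒∣m*n (suc e) p∣m′) , p∤* p∤e p∤e′ , +-/ m e m′ e′

  ν<ν⇒InPZp⁺ : ∀ {m n u v} .{{_ : NonZero n}} → ν[ m ]≡ u → ν[ n ]≡ v → v < u → InPZp⁺ (+ m ÷ n)
  ν<ν⇒InPZp⁺ {n = suc n} {v = v} _ (mkν zero _ n≡) _ = contradiction (trans n≡ (*-zeroʳ (p ^ v))) λ ()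
  ν<ν⇒InPZp⁺ {m} {suc n} {v = v} (mkν w _ m≡) (mkν (suc w′) p∤w′ n≡) v<u
    with c , refl ← m≤n⇒∃[o]m+o≡n v<u
    = p ^ suc c * w , w′ , ∣m⇒∣m*n w (m∣m*n (p ^ c)) , p∤w′ , *≡*⇒/≡/ m n (p ^ suc c * w) w′ cross
    where
    open ≡-Reasoning
    cross : m * suc w′ ≡ p ^ suc c * w * suc n
    cross = begin
      m * suc w′                        ≡⟨ cong (_* suc w′) m≡ ⟩
      p * p ^ (v + c) * w * suc w′      ≡⟨ cong (λ z → p * z * w * suc w′) (^-distribˡ-+-* p v c) ⟩
      p * (p ^ v * p ^ c) * w * suc w′  ≡⟨ solve 5 (λ p a b w x → p :* (a :* b) :* w :* x := p :* b :* w :* (a :* x)) refl p (p ^ v) (p ^ c) w (suc w′) ⟩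
      p * p ^ c * w * (p ^ v * suc w′)  ≡⟨ cong (_*_ (p * p ^ c * w)) n≡ ⟨
      p ^ suc c * w * suc n             ∎

  InPZp⁺-*-H-difference : ∀ c t s → (∀ j → t ≤ j → j < s + t → InPZp⁺ (c *ℚ (+ 1 ÷ suc j))) →
    InPZp⁺ (c *ℚ (H (s + t) -ℚ H t))
  InPZp⁺-*-H-difference c t zero    _       = subst InPZp⁺ (sym (*-[x-x] c (H t))) InPZp⁺-0
  InPZp⁺-*-H-difference c t (suc s) summand =
    subst InPZp⁺ (sym (*-[x+y-z] c (H (s + t)) (+ 1 ÷ suc (s + t)) (H t)))
      (InPZp⁺-+ (InPZp⁺-*-H-difference c t s (λ j t≤j j<s+t → summand j t≤j (m<n⇒m<1+n j<s+t)))
                (summand (s + t) (m≤n+m t s) ≤-refl))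

  B*H-difference-InPZp⁺ : ∀ {d} (a k L N : Fin d → ℕ) → (∀ i → L i ≤ N i) → (∀ i → a i < p) →
    InPZp⁺ (B N (λ i → a i + p * k i) *ℚ (H (dot L a / p + dot L k) -ℚ H (dot L k)))
  B*H-difference-InPZp⁺ a k L N L≤N a<p = InPZp⁺-*-H-difference (B N m) (dot L k) (dot L a / p) summand
    where
    m = λ i → a i + p * k i
    instance _ = prodFactPow-nz N m
    summand : ∀ j → dot L k ≤ j → j < dot L a / p + dot L k → InPZp⁺ (B N m *ℚ (+ 1 ÷ suc j))
    summand j t≤j j<s+t = subst InPZp⁺ (sym (*-/ (dot N m !) (prodFactPow N m) 1 (suc j)))
      (ν<ν⇒InPZp⁺ {{m*n≢0 (prodFactPow N m) (suc j)}}
        (subst (ν[_]≡ ν! (dot N m)) (sym (*-identityʳ _)) (ν!-spec (dot N m)))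
        (ν-* (ν-prodFactPow N m) (ν-spec (suc j)))
        (ν-B-summand< a k L N L≤N a<p j t≤j j<s+t))

floorDiv≡/ : ∀ n p .{{_ : NonZero p}} → floorDiv n p ≡ n / p
floorDiv≡/ n (suc p) = refl

lemma3 : (p : ℕ) → Prime p → (d : ℕ) → (a k L N : Fin d → ℕ) →
    (∀ i → L i ≤ N i) → (∀ i → a i < p) →
    InPZp p (B N (λ i → a i + p * k i) *ℚ
             (H (floorDiv (dot L a) p + dot L k) -ℚ H (dot L k)))
lemma3 p p-prime d a k L N L≤N a<p rewrite floorDiv≡/ (dot L a) p {{prime⇒nonZero p-prime}} =
  InPZp⁺⇒InPZp (B*H-difference-InPZp⁺ a k L N L≤N a<p)
  where open PAdic p-prime
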